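{- $\textsc{Empty-Child}=_{dt}\textsc{Lossy-Code}$; that is, $\textsc{Empty-Child}\le_{dt}\textsc{Lossy-Code}$ and $\textsc{Lossy-Code}\le_{dt}\textsc{Empty-Child}$.
   Context: Query model: inputs consist of functions between finite sets, accessed by querying the bits of the binary encodings of their values. For query total search problems $R,S$, $R\le_{dt}S$ means that each instance of $R$ (of size parameter $N$) can be solved via an instance of $S$ whose input bits are each computed by decision trees over the $R$-input, and whose solutions are mapped back to solutions of $R$ by decision trees, where the logarithm of the $S$-instance input length plus the maximum decision-tree depth is $\mathrm{polylog}(N)$. $\textsc{Lossy-Code}$: given $f:[N]\to[2N]$ and $g:[2N]\to[N]$, find $x\in[2N]$ with $f(g(x))\neq x$. $\textsc{Empty-Child}$: given a vertex set $V=[N]$ and functions $F,L,R:V\to V$ (father, left child, right child), a solution is either (s1) a vertex $u\in V$ with $F(L(u))\neq u$ or $F(R(u))\neq u$ or $L(u)=R(u)\neq u$; or (s2) the vertex $1$, if $L(1)=1$ or $R(1)=1$ or $F(1)\neq 1$. -}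

module Defs where

open import Data.Nat using (ℕ; zero; suc; _+_; _*_; _^_; _≤_; NonZero)
open import Data.Nat.DivMod using (_mod_)
open import Data.Nat.Logarithm using (⌈log₂_⌉)
open import Data.Fin using (Fin; toℕ) renaming (zero to fzero; suc to fsuc)
open import Data.Bool using (Bool; true; false; if_then_else_)
open import Data.Product using (_×_; _,_)
open import Data.Sum using (_⊎_; inj₁; inj₂)
open import Relation.Binary.PropositionalEquality using (_≡_; _≢_)
open import Relation.Nullary using (¬_)

data DT (I : Set) (A : Set) : Set where
  leaf  : A → DT I A
  query : I → (ifFalse ifTrue : DT I A) → DT I A

eval : {I A : Set} → DT I A → (I → Bool) → A
eval (leaf a)      x = a
eval (query i t u) x = if x i then eval u x else eval t x

depth : {I A : Set} → DT I A → ℕ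
depth (leaf _)      = 0
depth (query _ t u) = suc (depth t Data.Nat.⊔ depth u)

-- Query total search problems, indexed by a size parameter.
-- Convention: the size parameter n stands for N = suc n (so N ≥ 1).

record SearchProblem : Set₁ where
  field
    Bit   : ℕ → Set
    len   : ℕ → ℕ                       -- number of input bits (= |Bit n|)
    Sol   : ℕ → Set
    IsSol : (n : ℕ) → (Bit n → Bool) → Sol n → Set
open SearchProblem public

polylog : ℕ → ℕ → ℕ
polylog k n = k * ((⌈log₂ (suc n) ⌉ + 1) ^ k)

record _≤dt_ (R S : SearchProblem) : Set₁ where
  field
    size     : ℕ → ℕ     -- size parameter of the S-instance built from size-n R-instances
    inTree   : (n : ℕ) → Bit S (size n) → DT (Bit R n) Bool
    outTree  : (n : ℕ) → Sol S (size n) → DT (Bit R n) (Sol R n)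
    correct  : (n : ℕ) (x : Bit R n → Bool) (o : Sol S (size n)) →
               IsSol S (size n) (λ i → eval (inTree n i) x) o →
               IsSol R n x (eval (outTree n o) x)
    maxDepth : ℕ → ℕ
    inDepth  : (n : ℕ) (i : Bit S (size n)) → depth (inTree n i) ≤ maxDepth n
    outDepth : (n : ℕ) (o : Sol S (size n)) → depth (outTree n o) ≤ maxDepth n
    k        : ℕ
    cost     : (n : ℕ) → ⌈log₂ (len S (size n)) ⌉ + maxDepth n ≤ polylog k n
open _≤dt_ public

width : ℕ → ℕ
width K = ⌈log₂ K ⌉

decode : (w : ℕ) → (Fin w → Bool) → ℕ
decode zero    b = 0
decode (suc w) b = (if b fzero then 1 else 0) + 2 * decode w (λ j → b (fsuc j))

-- element of [K] represented by a bit string (out-of-range codes are read mod K)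
decodeFin : (K : ℕ) .{{_ : NonZero K}} → (Fin (width K) → Bool) → Fin K
decodeFin K b = decode (width K) b mod K

-- Lossy-Code, size N = suc n:  f : [N] → [2N],  g : [2N] → [N].

LCBit : ℕ → Set
LCBit n = (Fin (suc n) × Fin (width (2 * suc n)))
        ⊎ (Fin (2 * suc n) × Fin (width (suc n)))

LC-f : (n : ℕ) → (LCBit n → Bool) → Fin (suc n) → Fin (2 * suc n)
LC-f n x i = decodeFin (2 * suc n) (λ j → x (inj₁ (i , j)))

LC-g : (n : ℕ) → (LCBit n → Bool) → Fin (2 * suc n) → Fin (suc n)
LC-g n x y = decodeFin (suc n) (λ j → x (inj₂ (y , j)))

LossyCode : SearchProblem
LossyCode = record
  { Bit   = LCBit
  ; len   = λ n → suc n * width (2 * suc n) + 2 * suc n * width (suc n)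
  ; Sol   = λ n → Fin (2 * suc n)
  ; IsSol = λ n x y → LC-f n x (LC-g n x y) ≢ y
  }

-- Empty-Child, size N = suc n:  V = [N],  F, L, R : V → V.
-- Vertices are Fin (suc n); the paper's vertex 1 is fzero.

data Ptr : Set where
  Fp Lp Rp : Ptr

ECBit : ℕ → Set
ECBit n = Ptr × Fin (suc n) × Fin (width (suc n))

EC-ptr : (n : ℕ) → (ECBit n → Bool) → Ptr → Fin (suc n) → Fin (suc n)
EC-ptr n x p u = decodeFin (suc n) (λ j → x (p , u , j))

EC-s1 : (n : ℕ) → (ECBit n → Bool) → Fin (suc n) → Set
EC-s1 n x u =
  (F (L u) ≢ u) ⊎ (F (R u) ≢ u) ⊎ (L u ≡ R u × R u ≢ u)
  where
    F = EC-ptr n x Fp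
    L = EC-ptr n x Lp
    R = EC-ptr n x Rp

EC-s2 : (n : ℕ) → (ECBit n → Bool) → Fin (suc n) → Set
EC-s2 n x u =
  u ≡ fzero × ((L fzero ≡ fzero) ⊎ (R fzero ≡ fzero) ⊎ (F fzero ≢ fzero))
  where
    F = EC-ptr n x Fp
    L = EC-ptr n x Lp
    R = EC-ptr n x Rp

EmptyChild : SearchProblem
EmptyChild = record
  { Bit   = ECBit
  ; len   = λ n → 3 * (suc n * width (suc n))
  ; Sol   = λ n → Fin (suc n)
  ; IsSol = λ n x u → EC-s1 n x u ⊎ EC-s2 n x u
  }

-- Empty-Child ≤ Lossy-Code.  With D = ⌈log₂ N⌉, a code y ∈ [2·2^D] is read as a path of
-- length D + 1 from the root: g y is the vertex the path reaches, and f v is the path obtained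
-- by climbing D + 1 fathers from v.  While the path meets no Empty-Child solution, each step goes
-- to a child whose father is the current vertex and the two children differ, so climbing retraces
-- the path and f (g y) = y.  Hence every y with f (g y) ≠ y has a solution on its path.
--
-- Lossy-Code ≤ Empty-Child.  The vertices are a root 0 and v + 1 for v ∈ [N]; reading a vertex u
-- as a code, its children are 1 + g (b , g u) for b = 0, 1, where (b , a) ∈ [2] × [N] ≅ [2N], and
-- the father of v + 1 is recovered by re-encoding: f v = (b , a) and f a is the father's code.
-- If f ∘ g fixes (0 , g u), (1 , g u) and u, both children of u point back to u and are distinct,
-- so u is no solution; the output returns the first of these three codes that f ∘ g moves.

module Submission where

open import Defs
open import Data.Nat
  using (ℕ; zero; suc; _+_; _*_; _^_; _∸_; _≤_; _<_; NonZero; z≤n; s≤s; _%_; _/_; _≡ᵇ_; ⌈_/2⌉; ⌊_/2⌋)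
open import Data.Nat.Properties
open import Data.Nat.DivMod using (_mod_; m≡m%n+[m/n]*n; m%n<n; m<n⇒m%n≡m; m<n*o⇒m/o<n)
open import Data.Nat.Logarithm
open import Data.Nat.Induction using (<-rec)
open import Data.Nat.Tactic.RingSolver using (solve-∀)
open import Data.Fin using (Fin; toℕ; fromℕ<; inject≤; combine; remQuot) renaming (zero to fzero; suc to fsuc)
open import Data.Fin.Properties using (toℕ-injective; toℕ-fromℕ<; toℕ<n; toℕ-inject≤; remQuot-combine; combine-injectiveˡ)
  renaming (_≟_ to _≟ᶠ_; suc-injective to fsuc-injective)
open import Data.Bool using (Bool; true; false; if_then_else_)
open import Data.Product using (_×_; _,_; proj₁; proj₂)
open import Data.Sum using (_⊎_; inj₁; inj₂)
open import Data.Empty using (⊥-elim)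
open import Relation.Nullary using (¬_; Dec; yes; no; does)
open import Relation.Nullary.Decidable using (_⊎-dec_; _×-dec_; ¬?; decidable-stable)
open import Relation.Binary.PropositionalEquality

n≤2^⌈log₂n⌉ : ∀ n → n ≤ 2 ^ ⌈log₂ n ⌉
n≤2^⌈log₂n⌉ = <-rec _ bound
  where
  bound : ∀ n → (∀ {m} → m < n → m ≤ 2 ^ ⌈log₂ m ⌉) → n ≤ 2 ^ ⌈log₂ n ⌉
  bound zero          _   = z≤n
  bound (suc zero)    _   = s≤s z≤n
  bound n@(suc (suc j)) rec = begin
    n                          ≡⟨ sym (⌊n/2⌋+⌈n/2⌉≡n n) ⟩
    ⌊ n /2⌋ + ⌈ n /2⌉          ≤⟨ +-monoˡ-≤ ⌈ n /2⌉ (⌊n/2⌋≤⌈n/2⌉ n) ⟩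
    ⌈ n /2⌉ + ⌈ n /2⌉          ≡⟨ cong (⌈ n /2⌉ +_) (sym (+-identityʳ ⌈ n /2⌉)) ⟩
    2 * ⌈ n /2⌉                ≤⟨ *-monoʳ-≤ 2 (rec (⌈n/2⌉<n j)) ⟩
    2 * 2 ^ ⌈log₂ ⌈ n /2⌉ ⌉    ≡⟨ cong (λ e → 2 ^ suc e) (⌈log₂⌈n/2⌉⌉≡⌈log₂n⌉∸1 n) ⟩
    2 ^ suc (⌈log₂ n ⌉ ∸ 1)    ≡⟨ cong (2 ^_) (m+[n∸m]≡n {1} (⌈log₂⌉-mono-≤ {2} {n} (s≤s (s≤s z≤n)))) ⟩
    2 ^ ⌈log₂ n ⌉              ∎
    where open ≤-Reasoning

m≤2^n⇒⌈log₂m⌉≤n : ∀ {m n} → m ≤ 2 ^ n → ⌈log₂ m ⌉ ≤ n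
m≤2^n⇒⌈log₂m⌉≤n {m} {n} m≤2^n = subst (⌈log₂ m ⌉ ≤_) (⌈log₂2^n⌉≡n n) (⌈log₂⌉-mono-≤ m≤2^n)

n<2^n : ∀ n → n < 2 ^ n
n<2^n zero    = s≤s z≤n
n<2^n (suc n) = +-mono-≤ (m^n>0 2 n) (≤-trans (n<2^n n) (m≤m+n (2 ^ n) 0))

infixl 1 _>>=ᵀ_

_>>=ᵀ_ : {I A B : Set} → DT I A → (A → DT I B) → DT I B
leaf a        >>=ᵀ k = k a
query i t u   >>=ᵀ k = query i (t >>=ᵀ k) (u >>=ᵀ k)

eval->>= : {I A B : Set} (t : DT I A) (k : A → DT I B) (x : I → Bool) →
           eval (t >>=ᵀ k) x ≡ eval (k (eval t x)) x
eval->>= (leaf a)      k x = refl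
eval->>= (query i t u) k x with x i
... | true  = eval->>= u k x
... | false = eval->>= t k x

depth->>= : {I A B : Set} (t : DT I A) {k : A → DT I B} {d : ℕ} →
            (∀ a → depth (k a) ≤ d) → depth (t >>=ᵀ k) ≤ depth t + d
depth->>= (leaf a)      {d = d} bound = bound a
depth->>= (query i t u) {d = d} bound = s≤s (⊔-lub
  (≤-trans (depth->>= t bound) (+-monoˡ-≤ d (m≤m⊔n (depth t) (depth u))))
  (≤-trans (depth->>= u bound) (+-monoˡ-≤ d (m≤n⊔m (depth t) (depth u)))))

readNat : {I : Set} (w : ℕ) → (Fin w → I) → DT I ℕ
readNat zero    idx = leaf 0
readNat (suc w) idx = readNat w (λ j → idx (fsuc j)) >>=ᵀ λ r →
  query (idx fzero) (leaf (0 + 2 * r)) (leaf (1 + 2 * r))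

eval-readNat : {I : Set} (w : ℕ) (idx : Fin w → I) (x : I → Bool) →
               eval (readNat w idx) x ≡ decode w (λ j → x (idx j))
eval-readNat zero    idx x = refl
eval-readNat (suc w) idx x
  rewrite eval->>= (readNat w (λ j → idx (fsuc j)))
            (λ r → query (idx fzero) (leaf (0 + 2 * r)) (leaf (1 + 2 * r))) x
        | eval-readNat w (λ j → idx (fsuc j)) x
  with x (idx fzero)
... | true  = refl
... | false = refl

depth-readNat : {I : Set} (w : ℕ) (idx : Fin w → I) → depth (readNat w idx) ≤ w
depth-readNat zero    idx = z≤n
depth-readNat (suc w) idx = ≤-trans
  (depth->>= (readNat w (λ j → idx (fsuc j))) (λ _ → s≤s z≤n))
  (≤-trans (+-monoˡ-≤ 1 (depth-readNat w (λ j → idx (fsuc j)))) (≤-reflexive (+-comm w 1)))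

readFin : {I : Set} (K : ℕ) .{{_ : NonZero K}} → (Fin (width K) → I) → DT I (Fin K)
readFin K idx = readNat (width K) idx >>=ᵀ λ v → leaf (v mod K)

eval-readFin : {I : Set} (K : ℕ) .{{_ : NonZero K}} (idx : Fin (width K) → I) (x : I → Bool) →
               eval (readFin K idx) x ≡ decodeFin K (λ j → x (idx j))
eval-readFin K idx x = trans (eval->>= (readNat (width K) idx) (λ v → leaf (v mod K)) x)
                             (cong (_mod K) (eval-readNat (width K) idx x))

depth-readFin : {I : Set} (K : ℕ) .{{_ : NonZero K}} (idx : Fin (width K) → I) →
                depth (readFin K idx) ≤ width K
depth-readFin K idx = ≤-trans (depth->>= (readNat (width K) idx) (λ _ → z≤n))
                              (≤-trans (≤-reflexive (+-identityʳ _)) (depth-readNat (width K) idx))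

bits : (w : ℕ) → ℕ → Fin w → Bool
bits (suc w) v fzero    = v % 2 ≡ᵇ 1
bits (suc w) v (fsuc j) = bits w (v / 2) j

decode-cong : (w : ℕ) {a b : Fin w → Bool} → (∀ j → a j ≡ b j) → decode w a ≡ decode w b
decode-cong zero    a≗b = refl
decode-cong (suc w) a≗b
  rewrite a≗b fzero | decode-cong w (λ j → a≗b (fsuc j)) = refl

lowBit : ∀ v → (if v % 2 ≡ᵇ 1 then 1 else 0) ≡ v % 2
lowBit v with v % 2 | m%n<n v 2
... | 0           | _ = refl
... | 1           | _ = refl
... | suc (suc _) | s≤s (s≤s ())

decode-bits : ∀ w v → v < 2 ^ w → decode w (bits w v) ≡ v
decode-bits zero    zero    _          = refl
decode-bits zero    (suc v) (s≤s ())
decode-bits (suc w) v v<2^w+1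
  rewrite decode-bits w (v / 2) (m<n*o⇒m/o<n (subst (v <_) (*-comm 2 (2 ^ w)) v<2^w+1))
        | lowBit v
  = trans (cong (v % 2 +_) (*-comm 2 (v / 2))) (sym (m≡m%n+[m/n]*n v 2))

decodeFin-bits : (K : ℕ) .{{_ : NonZero K}} (v : Fin K) {b : Fin (width K) → Bool} →
                 (∀ j → b j ≡ bits (width K) (toℕ v) j) → decodeFin K b ≡ v
decodeFin-bits K v b≗bits = toℕ-injective (begin
  toℕ (decodeFin K _)              ≡⟨ toℕ-fromℕ< _ ⟩
  decode (width K) _ % K           ≡⟨ cong (_% K) (decode-cong (width K) b≗bits) ⟩
  decode (width K) (bits _ _) % K  ≡⟨ cong (_% K) (decode-bits (width K) (toℕ v) v<2^w) ⟩
  toℕ v % K                        ≡⟨ m<n⇒m%n≡m (toℕ<n v) ⟩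
  toℕ v                            ∎)
  where
  open ≡-Reasoning
  v<2^w : toℕ v < 2 ^ width K
  v<2^w = ≤-trans (toℕ<n v) (n≤2^⌈log₂n⌉ K)

toℕ-mod : ∀ a K .{{_ : NonZero K}} → toℕ (a mod K) ≡ a % K
toℕ-mod a K = toℕ-fromℕ< (m%n<n a K)

mod-toℕ : ∀ {K} .{{_ : NonZero K}} (v : Fin K) → toℕ v mod K ≡ v
mod-toℕ {K} v = toℕ-injective (trans (toℕ-mod (toℕ v) K) (m<n⇒m%n≡m (toℕ<n v)))

data Prog (Q : Set) (Ans : Q → Set) (A : Set) : Set where
  ret : A → Prog Q Ans A
  ask : (q : Q) → (Ans q → Prog Q Ans A) → Prog Q Ans A

module _ {Q : Set} {Ans : Q → Set} where

  infixl 1 _>>=ᴾ_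

  run : {A : Set} → Prog Q Ans A → ((q : Q) → Ans q) → A
  run (ret a)   o = a
  run (ask q k) o = run (k (o q)) o

  _>>=ᴾ_ : {A B : Set} → Prog Q Ans A → (A → Prog Q Ans B) → Prog Q Ans B
  ret a   >>=ᴾ k = k a
  ask q c >>=ᴾ k = ask q (λ r → c r >>=ᴾ k)

  run->>= : {A B : Set} (p : Prog Q Ans A) (k : A → Prog Q Ans B) (o : (q : Q) → Ans q) →
            run (p >>=ᴾ k) o ≡ run (k (run p o)) o
  run->>= (ret a)   k o = refl
  run->>= (ask q c) k o = run->>= (c (o q)) k o

  data AsksAtMost {A : Set} : ℕ → Prog Q Ans A → Set where
    done : ∀ {d a} → AsksAtMost d (ret a)
    asks : ∀ {d q k} → (∀ r → AsksAtMost d (k r)) → AsksAtMost (suc d) (ask q k)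

  asksAtMost-mono : ∀ {A d e} {p : Prog Q Ans A} → AsksAtMost d p → d ≤ e → AsksAtMost e p
  asksAtMost-mono done     _         = done
  asksAtMost-mono (asks h) (s≤s d≤e) = asks (λ r → asksAtMost-mono (h r) d≤e)

  asksAtMost->>= : ∀ {A B a b} (p : Prog Q Ans A) {k : A → Prog Q Ans B} →
                   AsksAtMost a p → (∀ r → AsksAtMost b (k r)) → AsksAtMost (a + b) (p >>=ᴾ k)
  asksAtMost->>= {a = a} (ret x) done   hk = asksAtMost-mono (hk x) (m≤n+m _ a)
  asksAtMost->>= (ask q c)       (asks hp) hk = asks (λ r → asksAtMost->>= (c r) (hp r) hk)

  infixl 4 _<$>ᴾ_

  _<$>ᴾ_ : {A B : Set} → (A → B) → Prog Q Ans A → Prog Q Ans B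
  f <$>ᴾ ret a   = ret (f a)
  f <$>ᴾ ask q k = ask q (λ r → f <$>ᴾ k r)

  run-<$>ᴾ : {A B : Set} (f : A → B) (p : Prog Q Ans A) (o : (q : Q) → Ans q) →
             run (f <$>ᴾ p) o ≡ f (run p o)
  run-<$>ᴾ f (ret a)   o = refl
  run-<$>ᴾ f (ask q k) o = run-<$>ᴾ f (k (o q)) o

  asksAtMost-<$>ᴾ : ∀ {A B d} (f : A → B) {p : Prog Q Ans A} → AsksAtMost d p → AsksAtMost d (f <$>ᴾ p)
  asksAtMost-<$>ᴾ f done     = done
  asksAtMost-<$>ᴾ f (asks h) = asks (λ r → asksAtMost-<$>ᴾ f (h r))

  bitᴾ : ∀ {K} → Prog Q Ans (Fin K) → Fin (width K) → Prog Q Ans Bool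
  bitᴾ {K} p j = (λ v → bits (width K) (toℕ v) j) <$>ᴾ p

  module Compile {I : Set} (answer : (q : Q) → DT I (Ans q)) where

    compile : {A : Set} → Prog Q Ans A → DT I A
    compile (ret a)   = leaf a
    compile (ask q k) = answer q >>=ᵀ λ r → compile (k r)

    eval-compile : ∀ {A} (p : Prog Q Ans A) (x : I → Bool) (o : (q : Q) → Ans q) →
                   (∀ q → eval (answer q) x ≡ o q) → eval (compile p) x ≡ run p o
    eval-compile (ret a)   x o answer≗o = refl
    eval-compile (ask q k) x o answer≗o
      rewrite eval->>= (answer q) (λ r → compile (k r)) x | answer≗o q =
      eval-compile (k (o q)) x o answer≗o

    depth-compile : ∀ {A w} → (∀ q → depth (answer q) ≤ w) →
                    ∀ {d} (p : Prog Q Ans A) → AsksAtMost d p → depth (compile p) ≤ d * w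
    depth-compile bound (ret a) done = z≤n
    depth-compile {w = w} bound {suc d} (ask q k) (asks h) = ≤-trans
      (depth->>= (answer q) (λ r → depth-compile bound (k r) (h r)))
      (+-monoˡ-≤ (d * w) (bound q))

    decodeFin-compile-bitᴾ : ∀ K .{{_ : NonZero K}} (p : Prog Q Ans (Fin K)) (x : I → Bool) (o : (q : Q) → Ans q) →
                             (∀ q → eval (answer q) x ≡ o q) →
                             decodeFin K (λ j → eval (compile (bitᴾ p j)) x) ≡ run p o
    decodeFin-compile-bitᴾ K p x o answer≗o = decodeFin-bits K (run p o) λ j →
      trans (eval-compile (bitᴾ p j) x o answer≗o) (run-<$>ᴾ _ p o)

module _ {N : ℕ} where

  LocalSol : (u l r fu fl fr : Fin (suc N)) → Set
  LocalSol u l r fu fl fr = ((fl ≢ u) ⊎ (fr ≢ u) ⊎ (l ≡ r × r ≢ u))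
                          ⊎ (u ≡ fzero × ((l ≡ fzero) ⊎ (r ≡ fzero) ⊎ (fu ≢ fzero)))

  -- Opaque so that  does (localSol? …)  stays neutral and can be abstracted by  with .
  opaque
    localSol? : ∀ u l r fu fl fr → Dec (LocalSol u l r fu fl fr)
    localSol? u l r fu fl fr =
      (¬? (fl ≟ᶠ u) ⊎-dec ¬? (fr ≟ᶠ u) ⊎-dec ((l ≟ᶠ r) ×-dec ¬? (r ≟ᶠ u)))
      ⊎-dec ((u ≟ᶠ fzero) ×-dec ((l ≟ᶠ fzero) ⊎-dec (r ≟ᶠ fzero) ⊎-dec ¬? (fu ≟ᶠ fzero)))

module BinaryTree {N : ℕ} (F L R : Fin (suc N) → Fin (suc N)) where

  V : Set
  V = Fin (suc N)

  root : V
  root = fzero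

  Solution : V → Set
  Solution u = LocalSol u (L u) (R u) (F u) (F (L u)) (F (R u))

  solution? : (u : V) → Dec (Solution u)
  solution? u = localSol? u (L u) (R u) (F u) (F (L u)) (F (R u))

  Anchored : V → Set
  Anchored u = u ≡ root ⊎ F u ≢ u

  module _ {u : V} (¬sol : ¬ Solution u) where

    father-left : F (L u) ≡ u
    father-left = decidable-stable (F (L u) ≟ᶠ u) λ ne → ¬sol (inj₁ (inj₁ ne))

    father-right : F (R u) ≡ u
    father-right = decidable-stable (F (R u) ≟ᶠ u) λ ne → ¬sol (inj₁ (inj₂ (inj₁ ne)))

    left≡right⇒right≡self : L u ≡ R u → R u ≡ u
    left≡right⇒right≡self l≡r = decidable-stable (R u ≟ᶠ u) λ ne → ¬sol (inj₁ (inj₂ (inj₂ (l≡r , ne))))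

    left≢self : Anchored u → L u ≢ u
    left≢self (inj₁ u≡root) l≡u = ¬sol (inj₂ (u≡root , inj₁ (trans l≡u u≡root)))
    left≢self (inj₂ fu≢u)   l≡u = fu≢u (trans (cong F (sym l≡u)) father-left)

    right≢self : Anchored u → R u ≢ u
    right≢self (inj₁ u≡root) r≡u = ¬sol (inj₂ (u≡root , inj₂ (inj₁ (trans r≡u u≡root))))
    right≢self (inj₂ fu≢u)   r≡u = fu≢u (trans (cong F (sym r≡u)) father-right)

    left-anchored : Anchored u → Anchored (L u)
    left-anchored anch = inj₂ λ fl≡l → left≢self anch (trans (sym fl≡l) father-left)

    right-anchored : Anchored u → Anchored (R u)
    right-anchored anch = inj₂ λ fr≡r → right≢self anch (trans (sym fr≡r) father-right)

  child : ℕ → V → V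
  child b u = if b ≡ᵇ 0 then L u else R u

  walk : ℕ → ℕ → V
  walk zero    c = root
  walk (suc d) c = child (c % 2) (walk d (c / 2))

  branch : V → V → ℕ
  branch w v = if does (L w ≟ᶠ v) then 0 else 1

  address : ℕ → V → ℕ
  address zero    v = 0
  address (suc d) v = 2 * address d (F v) + branch (F v) v

  -- Scans the path leading to  walk d c, endpoint excluded, for a solution.
  firstSolution : ℕ → ℕ → V
  firstSolution zero    c = root
  firstSolution (suc d) c =
    if does (solution? (firstSolution d (c / 2))) then firstSolution d (c / 2) else walk d (c / 2)

  ¬solution-if : ∀ a u → ¬ Solution (if does (solution? a) then a else u) → ¬ Solution a × ¬ Solution u
  ¬solution-if a u ¬sol with solution? a
  ... | yes sol = ⊥-elim (¬sol sol)
  ... | no ¬sol-a = ¬sol-a , ¬sol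

  branch-left : ∀ u → branch u (L u) ≡ 0
  branch-left u with L u ≟ᶠ L u
  ... | yes _   = refl
  ... | no  l≢l = ⊥-elim (l≢l refl)

  branch-right : ∀ u → L u ≢ R u → branch u (R u) ≡ 1
  branch-right u l≢r with L u ≟ᶠ R u
  ... | yes l≡r = ⊥-elim (l≢r l≡r)
  ... | no  _   = refl

  child-step : ∀ {u} b → b < 2 → ¬ Solution u → Anchored u →
               F (child b u) ≡ u × branch u (child b u) ≡ b × Anchored (child b u)
  child-step {u} 0 _ ¬sol anch = father-left ¬sol , branch-left u , left-anchored ¬sol anch
  child-step {u} 1 _ ¬sol anch =
    father-right ¬sol ,
    branch-right u (λ l≡r → right≢self ¬sol anch (left≡right⇒right≡self ¬sol l≡r)) ,
    right-anchored ¬sol anch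
  child-step (suc (suc _)) (s≤s (s≤s ())) _ _

  address-walk : ∀ d c → c < 2 ^ d → ¬ Solution (firstSolution d c) →
                 address d (walk d c) ≡ c × Anchored (walk d c)
  address-walk zero    zero    _          _    = refl , inj₁ refl
  address-walk zero    (suc c) (s≤s ())   _
  address-walk (suc d) c       c<2^[1+d]  ¬sol = address≡c , anchored
    where
    u v : V
    u = walk d (c / 2)
    v = child (c % 2) u
    ¬sol-first-u : ¬ Solution (firstSolution d (c / 2)) × ¬ Solution u
    ¬sol-first-u = ¬solution-if (firstSolution d (c / 2)) u ¬sol
    c/2<2^d : c / 2 < 2 ^ d
    c/2<2^d = m<n*o⇒m/o<n (subst (c <_) (*-comm 2 (2 ^ d)) c<2^[1+d])
    induction : address d u ≡ c / 2 × Anchored u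
    induction = address-walk d (c / 2) c/2<2^d (proj₁ ¬sol-first-u)
    step : F v ≡ u × branch u v ≡ c % 2 × Anchored v
    step = child-step (c % 2) (m%n<n c 2) (proj₂ ¬sol-first-u) (proj₂ induction)
    anchored : Anchored v
    anchored = proj₂ (proj₂ step)
    address≡c : address (suc d) v ≡ c
    address≡c = begin
      2 * address d (F v) + branch (F v) v  ≡⟨ cong (λ w → 2 * address d w + branch w v) (proj₁ step) ⟩
      2 * address d u + branch u v          ≡⟨ cong₂ (λ a b → 2 * a + b) (proj₁ induction) (proj₁ (proj₂ step)) ⟩
      2 * (c / 2) + c % 2                   ≡⟨ +-comm (2 * (c / 2)) (c % 2) ⟩
      c % 2 + 2 * (c / 2)                   ≡⟨ cong (c % 2 +_) (*-comm 2 (c / 2)) ⟩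
      c % 2 + c / 2 * 2                     ≡⟨ sym (m≡m%n+[m/n]*n c 2) ⟩
      c                                     ∎
      where open ≡-Reasoning

module _ (n : ℕ) (x : ECBit n → Bool) where

  open BinaryTree (EC-ptr n x Fp) (EC-ptr n x Lp) (EC-ptr n x Rp)

  solution⇒isSol : ∀ u → Solution u → IsSol EmptyChild n x u
  solution⇒isSol u      (inj₁ s)          = inj₁ s
  solution⇒isSol .fzero (inj₂ (refl , s)) = inj₂ (refl , s)

  isSol⇒solution : ∀ u → IsSol EmptyChild n x u → Solution u
  isSol⇒solution u      (inj₁ s)          = inj₁ s
  isSol⇒solution .fzero (inj₂ (refl , s)) = inj₂ (refl , s)

solution-cong : ∀ {N} {F L R F′ L′ R′ : Fin (suc N) → Fin (suc N)} →
                (∀ u → F u ≡ F′ u) → (∀ u → L u ≡ L′ u) → (∀ u → R u ≡ R′ u) →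
                ∀ {u} → BinaryTree.Solution F L R u → BinaryTree.Solution F′ L′ R′ u
solution-cong {F = F} {L} {R} {F′} F≗F′ L≗L′ R≗R′ {u} =
  localSol-cong (L≗L′ u) (R≗R′ u) (F≗F′ u)
    (trans (F≗F′ (L u)) (cong F′ (L≗L′ u))) (trans (F≗F′ (R u)) (cong F′ (R≗R′ u)))
  where
  localSol-cong : ∀ {l r fu fl fr l′ r′ fu′ fl′ fr′} →
                  l ≡ l′ → r ≡ r′ → fu ≡ fu′ → fl ≡ fl′ → fr ≡ fr′ →
                  LocalSol u l r fu fl fr → LocalSol u l′ r′ fu′ fl′ fr′
  localSol-cong refl refl refl refl refl s = s

n≤n³ : ∀ n → n ≤ n ^ 3
n≤n³ zero    = z≤n
n≤n³ (suc k) = m≤m*n (suc k) (suc k ^ 2)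

polylog-bound : ∀ n {D ℓ d} → D ≡ ⌈log₂ (suc n) ⌉ →
                ℓ ≤ 2 ^ (2 + (suc D + suc D)) → d ≤ 7 * suc D ^ 3 → ⌈log₂ ℓ ⌉ + d ≤ polylog 11 n
polylog-bound n {D} {ℓ} {d} D≡log ℓ≤2^[2+2E] d≤7E³ = begin
  ⌈log₂ ℓ ⌉ + d          ≤⟨ +-mono-≤ (m≤2^n⇒⌈log₂m⌉≤n {n = 2 + (E + E)} ℓ≤2^[2+2E]) d≤7E³ ⟩
  2 + (E + E) + 7 * E ^ 3  ≤⟨ +-monoˡ-≤ (7 * E ^ 3) (subst (2 + (E + E) ≤_) (sym (expand D)) (m≤m+n _ (2 * D))) ⟩
  4 * E + 7 * E ^ 3      ≤⟨ +-monoˡ-≤ (7 * E ^ 3) (*-monoʳ-≤ 4 (n≤n³ E)) ⟩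
  4 * E ^ 3 + 7 * E ^ 3  ≡⟨ sym (*-distribʳ-+ (E ^ 3) 4 7) ⟩
  11 * E ^ 3             ≤⟨ *-monoʳ-≤ 11 (^-monoʳ-≤ E {3} {11} (s≤s (s≤s (s≤s z≤n)))) ⟩
  11 * E ^ 11            ≡⟨ cong (λ e → 11 * e ^ 11) (trans (+-comm 1 D) (cong (_+ 1) D≡log)) ⟩
  polylog 11 n           ∎
  where
  open ≤-Reasoning
  E : ℕ
  E = suc D
  expand : ∀ t → 4 * suc t ≡ 2 + (suc t + suc t) + 2 * t
  expand = solve-∀

module EmptyChild≤LossyCode (n : ℕ) where

  -- Opaque so that ⌈log₂_⌉, defined by well-founded recursion, is never unfolded by the type checker.
  opaque
    D : ℕ
    D = width (suc n)

    D≡width : D ≡ width (suc n)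
    D≡width = refl

    1+n≤2^D : suc n ≤ 2 ^ D
    1+n≤2^D = n≤2^⌈log₂n⌉ (suc n)

  m : ℕ
  m = 2 ^ D ∸ 1

  1+m≡2^D : suc m ≡ 2 ^ D
  1+m≡2^D = m+[n∸m]≡n (m^n>0 2 D)

  V : Set
  V = Fin (suc n)

  Query : Set
  Query = Ptr × V

  Pg : Set → Set
  Pg = Prog Query (λ _ → V)

  readPointer : (q : Query) → DT (ECBit n) V
  readPointer (p , u) = readFin (suc n) (λ j → p , u , j)

  open Compile readPointer

  walkᴾ : ℕ → ℕ → Pg V
  walkᴾ zero    c = ret fzero
  walkᴾ (suc d) c = walkᴾ d (c / 2) >>=ᴾ λ u → ask (Lp , u) λ l → ask (Rp , u) λ r →
                    ret (if c % 2 ≡ᵇ 0 then l else r)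

  addressᴾ : ℕ → V → Pg ℕ
  addressᴾ zero    v = ret 0
  addressᴾ (suc d) v = ask (Fp , v) λ w → ask (Lp , w) λ lw → addressᴾ d w >>=ᴾ λ a →
                       ret (2 * a + (if does (lw ≟ᶠ v) then 0 else 1))

  firstSolutionᴾ : ℕ → ℕ → Pg V
  firstSolutionᴾ zero    c = ret fzero
  firstSolutionᴾ (suc d) c =
    firstSolutionᴾ d (c / 2) >>=ᴾ λ a → ask (Lp , a) λ l → ask (Rp , a) λ r →
    ask (Fp , a) λ fa → ask (Fp , l) λ fl → ask (Fp , r) λ fr → walkᴾ d (c / 2) >>=ᴾ λ u →
    ret (if does (localSol? a l r fa fl fr) then a else u)

  module Semantics (o : Query → V) where

    open BinaryTree (λ u → o (Fp , u)) (λ u → o (Lp , u)) (λ u → o (Rp , u)) public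

    run-walkᴾ : ∀ d c → run (walkᴾ d c) o ≡ walk d c
    run-walkᴾ zero    c = refl
    run-walkᴾ (suc d) c = trans (run->>= (walkᴾ d (c / 2)) _ o) (cong (child (c % 2)) (run-walkᴾ d (c / 2)))

    run-addressᴾ : ∀ d v → run (addressᴾ d v) o ≡ address d v
    run-addressᴾ zero    v = refl
    run-addressᴾ (suc d) v = trans (run->>= (addressᴾ d w) _ o)
                                   (cong (λ a → 2 * a + branch w v) (run-addressᴾ d w))
      where w = o (Fp , v)

    run-firstSolutionᴾ : ∀ d c → run (firstSolutionᴾ d c) o ≡ firstSolution d c
    run-firstSolutionᴾ zero    c = refl
    run-firstSolutionᴾ (suc d) c =
      trans (run->>= (firstSolutionᴾ d (c / 2)) _ o)
      (trans (run->>= (walkᴾ d (c / 2)) _ o)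
             (cong₂ (λ a u → if does (solution? a) then a else u)
                    (run-firstSolutionᴾ d (c / 2)) (run-walkᴾ d (c / 2))))

  vertex<1+m : (v : V) → toℕ v < suc m
  vertex<1+m v = ≤-trans (toℕ<n v) (subst (suc n ≤_) (sym 1+m≡2^D) 1+n≤2^D)

  embed : V → Fin (suc m)
  embed v = fromℕ< (vertex<1+m v)

  gᴾ : Fin (2 * suc m) → Pg (Fin (suc m))
  gᴾ y = embed <$>ᴾ walkᴾ (suc D) (toℕ y)

  -- Only the values of f at embedded vertices matter; other arguments are reduced mod N.
  fᴾ : Fin (suc m) → Pg (Fin (2 * suc m))
  fᴾ t = (_mod (2 * suc m)) <$>ᴾ addressᴾ (suc D) (toℕ t mod suc n)

  inputBit : LCBit m → Pg Bool
  inputBit (inj₁ (t , j)) = bitᴾ (fᴾ t) j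
  inputBit (inj₂ (y , j)) = bitᴾ (gᴾ y) j

  inputTree : LCBit m → DT (ECBit n) Bool
  inputTree i = compile (inputBit i)

  outputTree : Fin (2 * suc m) → DT (ECBit n) V
  outputTree y = compile (firstSolutionᴾ (suc D) (toℕ y))

  embed-mod : ∀ v → toℕ (embed v) mod suc n ≡ v
  embed-mod v = trans (cong (_mod suc n) (toℕ-fromℕ< (vertex<1+m v))) (mod-toℕ v)

  module Correctness (x : ECBit n → Bool) where

    o : Query → V
    o (p , u) = EC-ptr n x p u

    open Semantics o

    readPointer-correct : ∀ q → eval (readPointer q) x ≡ o q
    readPointer-correct (p , u) = eval-readFin (suc n) (λ j → p , u , j) x

    x′ : LCBit m → Bool
    x′ i = eval (inputTree i) x

    f∘g : ∀ y → LC-f m x′ (LC-g m x′ y) ≡ address (suc D) (walk (suc D) (toℕ y)) mod (2 * suc m)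
    f∘g y = begin
      LC-f m x′ (LC-g m x′ y)
        ≡⟨ decodeFin-compile-bitᴾ (2 * suc m) (fᴾ (LC-g m x′ y)) x o readPointer-correct ⟩
      run (fᴾ (LC-g m x′ y)) o
        ≡⟨ cong (λ t → run (fᴾ t) o) g≡ ⟩
      run (fᴾ (embed v)) o
        ≡⟨ run-<$>ᴾ _ (addressᴾ (suc D) (toℕ (embed v) mod suc n)) o ⟩
      run (addressᴾ (suc D) (toℕ (embed v) mod suc n)) o mod (2 * suc m)
        ≡⟨ cong (λ w → run (addressᴾ (suc D) w) o mod (2 * suc m)) (embed-mod v) ⟩
      run (addressᴾ (suc D) v) o mod (2 * suc m)
        ≡⟨ cong (_mod (2 * suc m)) (run-addressᴾ (suc D) v) ⟩
      address (suc D) v mod (2 * suc m) ∎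
      where
      open ≡-Reasoning
      v = walk (suc D) (toℕ y)
      g≡ : LC-g m x′ y ≡ embed v
      g≡ = trans (decodeFin-compile-bitᴾ (suc m) (gᴾ y) x o readPointer-correct)
                 (trans (run-<$>ᴾ embed (walkᴾ (suc D) (toℕ y)) o) (cong embed (run-walkᴾ (suc D) (toℕ y))))

    correct₁ : ∀ y → IsSol LossyCode m x′ y → IsSol EmptyChild n x (eval (outputTree y) x)
    correct₁ y f∘g≢id = subst (IsSol EmptyChild n x) (sym output≡) (found (solution? u))
      where
      c = toℕ y
      u = firstSolution (suc D) c
      output≡ : eval (outputTree y) x ≡ u
      output≡ = trans (eval-compile (firstSolutionᴾ (suc D) c) x o readPointer-correct)
                      (run-firstSolutionᴾ (suc D) c)
      c<2^[1+D] : c < 2 ^ suc D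
      c<2^[1+D] = subst (λ M → c < 2 * M) 1+m≡2^D (toℕ<n y)
      found : Dec (Solution u) → IsSol EmptyChild n x u
      found (yes sol)  = solution⇒isSol n x u sol
      found (no  ¬sol) = ⊥-elim (f∘g≢id (trans (f∘g y)
        (trans (cong (_mod (2 * suc m)) (proj₁ (address-walk (suc D) c c<2^[1+D] ¬sol))) (mod-toℕ y))))

  readPointer-depth : ∀ q → depth (readPointer q) ≤ D
  readPointer-depth (p , u) =
    subst (depth (readPointer (p , u)) ≤_) (sym D≡width) (depth-readFin (suc n) (λ j → p , u , j))

  walkᴾ-asks : ∀ d c → AsksAtMost (2 * d) (walkᴾ d c)
  walkᴾ-asks zero    c = done
  walkᴾ-asks (suc d) c = asksAtMost-mono
    (asksAtMost->>= (walkᴾ d (c / 2)) (walkᴾ-asks d (c / 2)) (λ _ → asks λ _ → asks λ _ → done))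
    (≤-reflexive (trans (+-comm (2 * d) 2) (sym (*-suc 2 d))))

  addressᴾ-asks : ∀ d v → AsksAtMost (2 * d) (addressᴾ d v)
  addressᴾ-asks zero    v = done
  addressᴾ-asks (suc d) v = asksAtMost-mono
    (asks λ w → asks λ _ → asksAtMost->>= (addressᴾ d w) (addressᴾ-asks d w) (λ _ → done))
    (≤-reflexive (trans (cong (2 +_) (+-identityʳ (2 * d))) (sym (*-suc 2 d))))

  firstSolutionᴾ-asks : ∀ d c → AsksAtMost (d * (d + 6)) (firstSolutionᴾ d c)
  firstSolutionᴾ-asks zero    c = done
  firstSolutionᴾ-asks (suc d) c = asksAtMost-mono
    (asksAtMost->>= (firstSolutionᴾ d (c / 2)) (firstSolutionᴾ-asks d (c / 2)) λ _ →
      asks λ _ → asks λ _ → asks λ _ → asks λ _ → asks λ _ →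
      asksAtMost->>= (walkᴾ d (c / 2)) (walkᴾ-asks d (c / 2)) (λ _ → done))
    (≤-trans (m≤m+n _ 2) (≤-reflexive (sym (step d))))
    where
    step : ∀ t → suc t * (suc t + 6) ≡ t * (t + 6) + (5 + (2 * t + 0)) + 2
    step = solve-∀

  maxAsks : ℕ
  maxAsks = suc D * (suc D + 6)

  2*[1+D]≤maxAsks : 2 * suc D ≤ maxAsks
  2*[1+D]≤maxAsks = subst (_≤ maxAsks) (*-comm (suc D) 2) (*-monoʳ-≤ (suc D) (≤-trans (s≤s (s≤s z≤n)) (m≤n+m 6 (suc D))))

  inputBit-asks : ∀ i → AsksAtMost maxAsks (inputBit i)
  inputBit-asks (inj₁ (t , j)) =
    asksAtMost-<$>ᴾ _ (asksAtMost-<$>ᴾ _ (asksAtMost-mono (addressᴾ-asks (suc D) (toℕ t mod suc n)) 2*[1+D]≤maxAsks))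
  inputBit-asks (inj₂ (y , j)) =
    asksAtMost-<$>ᴾ _ (asksAtMost-<$>ᴾ _ (asksAtMost-mono (walkᴾ-asks (suc D) (toℕ y)) 2*[1+D]≤maxAsks))

  maxAsks*D≤7[1+D]³ : maxAsks * D ≤ 7 * suc D ^ 3
  maxAsks*D≤7[1+D]³ = subst (maxAsks * D ≤_) (sym (expand D)) (m≤m+n (maxAsks * D) _)
    where
    expand : ∀ t → 7 * (suc t * (suc t * (suc t * 1))) ≡ suc t * (suc t + 6) * t + suc t * (6 * t * t + 7 * t + 7)
    expand = solve-∀

  length≤ : len LossyCode m ≤ 2 ^ (2 + (suc D + suc D))
  length≤ = begin
    suc m * width (2 * suc m) + 2 * suc m * width (suc m)  ≡⟨ cong (λ M → M * width (2 * M) + 2 * M * width M) 1+m≡2^D ⟩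
    P * width (2 ^ suc D) + 2 * P * width P                 ≡⟨ cong₂ (λ a b → P * a + 2 * P * b) (⌈log₂2^n⌉≡n (suc D)) (⌈log₂2^n⌉≡n D) ⟩
    P * suc D + 2 * P * D                                   ≤⟨ +-mono-≤ (*-monoʳ-≤ P (n<2^n D)) (*-monoʳ-≤ (2 * P) (<⇒≤ (n<2^n D))) ⟩
    P * P + 2 * P * P                                       ≤⟨ m≤m+n (P * P + 2 * P * P) (P * P) ⟩
    P * P + 2 * P * P + P * P                               ≡⟨ expand P ⟩
    2 * (2 * (P * P))                                       ≡⟨ cong (λ z → 2 * (2 * z)) (sym (^-distribˡ-+-* 2 D D)) ⟩
    2 ^ (2 + (D + D))                                       ≤⟨ ^-monoʳ-≤ 2 (+-monoʳ-≤ 2 (+-mono-≤ (n≤1+n D) (n≤1+n D))) ⟩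
    2 ^ (2 + (suc D + suc D))                               ∎
    where
    open ≤-Reasoning
    P = 2 ^ D
    expand : ∀ p → p * p + 2 * p * p + p * p ≡ 2 * (2 * (p * p))
    expand = solve-∀

  cost₁ : ⌈log₂ (len LossyCode m) ⌉ + maxAsks * D ≤ polylog 11 n
  cost₁ = polylog-bound n D≡width length≤ maxAsks*D≤7[1+D]³

  inputTree-depth : ∀ i → depth (inputTree i) ≤ maxAsks * D
  inputTree-depth i = depth-compile readPointer-depth (inputBit i) (inputBit-asks i)

  outputTree-depth : ∀ y → depth (outputTree y) ≤ maxAsks * D
  outputTree-depth y = depth-compile readPointer-depth (firstSolutionᴾ (suc D) (toℕ y)) (firstSolutionᴾ-asks (suc D) (toℕ y))

emptyChild≤lossyCode : EmptyChild ≤dt LossyCode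
emptyChild≤lossyCode = record
  { size     = m
  ; inTree   = inputTree
  ; outTree  = outputTree
  ; correct  = λ n x → Correctness.correct₁ n x
  ; maxDepth = λ n → maxAsks n * D n
  ; inDepth  = inputTree-depth
  ; outDepth = outputTree-depth
  ; k        = 11
  ; cost     = cost₁
  }
  where open EmptyChild≤LossyCode

module LossyCode≤EmptyChild (n : ℕ) where

  N : ℕ
  N = suc n

  V : Set
  V = Fin (suc N)

  Code : Set
  Code = Fin (2 * N)

  1+N≤2*N : suc N ≤ 2 * N
  1+N≤2*N = s≤s (≤-trans (m≤n+m (suc n) n) (≤-reflexive (cong (n +_) (sym (*-identityˡ (suc n))))))

  codeOf : V → Code
  codeOf u = inject≤ u 1+N≤2*N

  vertexOf : Code → V
  vertexOf y = toℕ y mod suc N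

  vertexOf-codeOf : ∀ u → vertexOf (codeOf u) ≡ u
  vertexOf-codeOf u = trans (cong (_mod suc N) (toℕ-inject≤ u 1+N≤2*N)) (mod-toℕ u)

  b₀ b₁ : Fin 2
  b₀ = fzero
  b₁ = fsuc fzero

  pair : Fin 2 → Fin N → Code
  pair = combine

  unpair : Code → Fin 2 × Fin N
  unpair = remQuot N

  data Query : Set where
    qf : Fin N → Query
    qg : Code → Query

  Answer : Query → Set
  Answer (qf _) = Code
  Answer (qg _) = Fin N

  Pg : Set → Set
  Pg = Prog Query Answer

  readValue : (q : Query) → DT (LCBit n) (Answer q)
  readValue (qf i) = readFin (2 * N) (λ j → inj₁ (i , j))
  readValue (qg y) = readFin N (λ j → inj₂ (y , j))

  open Compile readValue

  childᴾ : Fin 2 → V → Pg V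
  childᴾ b u = ask (qg (codeOf u)) λ a → ask (qg (pair b a)) λ v → ret (fsuc v)

  pointerᴾ : Ptr → V → Pg V
  pointerᴾ Fp fzero    = ret fzero
  pointerᴾ Fp (fsuc v) = ask (qf v) λ z → ask (qf (proj₂ (unpair z))) λ y → ret (vertexOf y)
  pointerᴾ Lp u        = childᴾ b₀ u
  pointerᴾ Rp u        = childᴾ b₁ u

  outputᴾ : V → Pg Code
  outputᴾ u = ask (qg (codeOf u)) λ a →
    ask (qg (pair b₀ a)) λ v₀ → ask (qf v₀) λ w₀ →
    ask (qg (pair b₁ a)) λ v₁ → ask (qf v₁) λ w₁ →
    ret (if does (w₀ ≟ᶠ pair b₀ a) then (if does (w₁ ≟ᶠ pair b₁ a) then codeOf u
                                               else pair b₁ a)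
         else pair b₀ a)

  module Semantics (f : Fin N → Code) (g : Code → Fin N) where

    o : (q : Query) → Answer q
    o (qf i) = f i
    o (qg y) = g y

    Fixed : Code → Set
    Fixed c = f (g c) ≡ c

    childCode : Fin 2 → V → Code
    childCode b u = pair b (g (codeOf u))

    F : V → V
    F fzero    = fzero
    F (fsuc v) = vertexOf (f (proj₂ (unpair (f v))))

    child : Fin 2 → V → V
    child b u = fsuc (g (childCode b u))

    pointer : Ptr → V → V
    pointer Fp = F
    pointer Lp = child b₀
    pointer Rp = child b₁

    run-pointerᴾ : ∀ p u → run (pointerᴾ p u) o ≡ pointer p u
    run-pointerᴾ Fp fzero    = refl
    run-pointerᴾ Fp (fsuc v) = refl
    run-pointerᴾ Lp u        = refl
    run-pointerᴾ Rp u        = refl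

    father-child : ∀ b u → Fixed (childCode b u) → Fixed (codeOf u) → F (child b u) ≡ u
    father-child b u fixed-child fixed-u = begin
      vertexOf (f (proj₂ (unpair (f (g (childCode b u))))))  ≡⟨ cong (λ c → vertexOf (f (proj₂ (unpair c)))) fixed-child ⟩
      vertexOf (f (proj₂ (unpair (childCode b u))))          ≡⟨ cong (λ p → vertexOf (f (proj₂ p))) (remQuot-combine {2} b (g (codeOf u))) ⟩
      vertexOf (f (g (codeOf u)))                               ≡⟨ cong vertexOf fixed-u ⟩
      vertexOf (codeOf u)                                       ≡⟨ vertexOf-codeOf u ⟩
      u                                                         ∎
      where open ≡-Reasoning

    children-distinct : ∀ u → Fixed (childCode b₀ u) → Fixed (childCode b₁ u) →
                        child b₀ u ≢ child b₁ u
    children-distinct u fixed₀ fixed₁ children≡ with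
      combine-injectiveˡ b₀ (g (codeOf u)) b₁ (g (codeOf u))
        (trans (sym fixed₀) (trans (cong f (fsuc-injective children≡)) fixed₁))
    ... | ()

    open BinaryTree F (child b₀) (child b₁) using (Solution)

    fixed⇒¬solution : ∀ u → Fixed (childCode b₀ u) → Fixed (childCode b₁ u) → Fixed (codeOf u) →
                       ¬ Solution u
    fixed⇒¬solution u fixed₀ fixed₁ fixed-u (inj₁ (inj₁ ne))               = ne (father-child b₀ u fixed₀ fixed-u)
    fixed⇒¬solution u fixed₀ fixed₁ fixed-u (inj₁ (inj₂ (inj₁ ne)))        = ne (father-child b₁ u fixed₁ fixed-u)
    fixed⇒¬solution u fixed₀ fixed₁ fixed-u (inj₁ (inj₂ (inj₂ (l≡r , _)))) = children-distinct u fixed₀ fixed₁ l≡r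
    fixed⇒¬solution u fixed₀ fixed₁ fixed-u (inj₂ (_ , inj₁ ()))
    fixed⇒¬solution u fixed₀ fixed₁ fixed-u (inj₂ (_ , inj₂ (inj₁ ())))
    fixed⇒¬solution u fixed₀ fixed₁ fixed-u (inj₂ (refl , inj₂ (inj₂ F0≢0))) = F0≢0 refl

    output : V → Code
    output u = if does (f (g (childCode b₀ u)) ≟ᶠ childCode b₀ u)
               then (if does (f (g (childCode b₁ u)) ≟ᶠ childCode b₁ u) then codeOf u else childCode b₁ u)
               else childCode b₀ u

    output-unfixed : ∀ u → Solution u → ¬ Fixed (output u)
    output-unfixed u sol with f (g (childCode b₀ u)) ≟ᶠ childCode b₀ u
    ... | no ¬fixed₀ = ¬fixed₀
    ... | yes fixed₀ with f (g (childCode b₁ u)) ≟ᶠ childCode b₁ u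
    ...   | no ¬fixed₁ = ¬fixed₁
    ...   | yes fixed₁ = λ fixed-u → fixed⇒¬solution u fixed₀ fixed₁ fixed-u sol

  inputBit : ECBit (suc n) → Pg Bool
  inputBit (p , u , j) = bitᴾ (pointerᴾ p u) j

  inputTree : ECBit (suc n) → DT (LCBit n) Bool
  inputTree i = compile (inputBit i)

  outputTree : V → DT (LCBit n) Code
  outputTree u = compile (outputᴾ u)

  module Correctness (x : LCBit n → Bool) where

    open Semantics (LC-f n x) (LC-g n x)

    readValue-correct : ∀ q → eval (readValue q) x ≡ o q
    readValue-correct (qf i) = eval-readFin (2 * N) (λ j → inj₁ (i , j)) x
    readValue-correct (qg y) = eval-readFin N (λ j → inj₂ (y , j)) x

    x′ : ECBit (suc n) → Bool
    x′ i = eval (inputTree i) x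

    pointer-correct : ∀ p u → EC-ptr (suc n) x′ p u ≡ pointer p u
    pointer-correct p u =
      trans (decodeFin-compile-bitᴾ (suc N) (pointerᴾ p u) x o readValue-correct) (run-pointerᴾ p u)

    correct₂ : ∀ u → IsSol EmptyChild (suc n) x′ u → IsSol LossyCode n x (eval (outputTree u) x)
    correct₂ u sol = subst (λ c → ¬ Fixed c) (sym (eval-compile (outputᴾ u) x o readValue-correct))
      (output-unfixed u (solution-cong (pointer-correct Fp) (pointer-correct Lp) (pointer-correct Rp)
                                       (isSol⇒solution (suc n) x′ u sol)))

  W : ℕ
  W = width (2 * N)

  W≡1+log : W ≡ suc ⌈log₂ (suc n) ⌉
  W≡1+log = ⌈log₂2*n⌉≡1+⌈log₂n⌉ N

  readValue-depth : ∀ q → depth (readValue q) ≤ W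
  readValue-depth (qf i) = depth-readFin (2 * N) (λ j → inj₁ (i , j))
  readValue-depth (qg y) = ≤-trans (depth-readFin N (λ j → inj₂ (y , j))) (⌈log₂⌉-mono-≤ (m≤m+n N (N + 0)))

  inputBit-asks : ∀ i → AsksAtMost 5 (inputBit i)
  inputBit-asks (Fp , fzero  , j) = done
  inputBit-asks (Fp , fsuc v , j) = asks λ _ → asks λ _ → done
  inputBit-asks (Lp , u      , j) = asks λ _ → asks λ _ → done
  inputBit-asks (Rp , u      , j) = asks λ _ → asks λ _ → done

  outputᴾ-asks : ∀ u → AsksAtMost 5 (outputᴾ u)
  outputᴾ-asks u = asks λ _ → asks λ _ → asks λ _ → asks λ _ → asks λ _ → done

  inputTree-depth : ∀ i → depth (inputTree i) ≤ 5 * W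
  inputTree-depth i = depth-compile readValue-depth (inputBit i) (inputBit-asks i)

  outputTree-depth : ∀ u → depth (outputTree u) ≤ 5 * W
  outputTree-depth u = depth-compile readValue-depth (outputᴾ u) (outputᴾ-asks u)

  length≤ : len EmptyChild (suc n) ≤ 2 ^ (2 + (W + W))
  length≤ = begin
    3 * (suc N * width (suc N))  ≤⟨ *-monoˡ-≤ (suc N * width (suc N)) (n≤1+n 3) ⟩
    4 * (suc N * width (suc N))  ≤⟨ *-monoʳ-≤ 4 (*-mono-≤ 1+N≤2^W width≤2^W) ⟩
    4 * (2 ^ W * 2 ^ W)          ≡⟨ *-assoc 2 2 (2 ^ W * 2 ^ W) ⟩
    2 * (2 * (2 ^ W * 2 ^ W))    ≡⟨ cong (λ z → 2 * (2 * z)) (sym (^-distribˡ-+-* 2 W W)) ⟩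
    2 ^ (2 + (W + W))            ∎
    where
    open ≤-Reasoning
    1+N≤2^W : suc N ≤ 2 ^ W
    1+N≤2^W = ≤-trans 1+N≤2*N (n≤2^⌈log₂n⌉ (2 * N))
    width≤2^W : width (suc N) ≤ 2 ^ W
    width≤2^W = ≤-trans (⌈log₂⌉-mono-≤ 1+N≤2*N) (<⇒≤ (n<2^n W))

  cost₂ : ⌈log₂ (len EmptyChild (suc n)) ⌉ + 5 * W ≤ polylog 11 n
  cost₂ = polylog-bound n refl
    (subst (λ w → len EmptyChild (suc n) ≤ 2 ^ (2 + (w + w))) W≡1+log length≤)
    (subst (λ w → 5 * W ≤ 7 * w ^ 3) W≡1+log (*-mono-≤ (m≤m+n 5 2) (n≤n³ W)))

lossyCode≤emptyChild : LossyCode ≤dt EmptyChild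
lossyCode≤emptyChild = record
  { size     = suc
  ; inTree   = inputTree
  ; outTree  = outputTree
  ; correct  = λ n x → Correctness.correct₂ n x
  ; maxDepth = λ n → 5 * W n
  ; inDepth  = inputTree-depth
  ; outDepth = outputTree-depth
  ; k        = 11
  ; cost     = cost₂
  }
  where open LossyCode≤EmptyChild

theorem1p6 : (EmptyChild ≤dt LossyCode) × (LossyCode ≤dt EmptyChild)
theorem1p6 = emptyChild≤lossyCode , lossyCode≤emptyChild
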